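{- Let $G$ be a connected triangle-free graph with at least three vertices. Then $(G,k)$ is niche-realizable for some integer $k\ge 3$ if and only if $k\in\{3,4,5\}$ and $G$ is isomorphic to a member of $\{P_3,P_4,P_5,C_5,C_6,G_4,G_5\}$ when $k=3$; of $\{P_4,C_5\}$ when $k=4$; of $\{C_5\}$ when $k=5$.
   Context: $P_n$ and $C_n$ denote the path and cycle on $n$ vertices. $G_4$ is the graph on vertices $a,b,c,d,e$ with edges $ab,ad,bc,cd,de,eb$ (isomorphic to $K_{2,3}$). $G_5$ is the graph on vertices $x_1,\dots,x_6$ with edges $x_1x_2,x_2x_3,x_3x_4,x_4x_5,x_5x_6,x_6x_1,x_1x_4,x_2x_5,x_3x_6$ (isomorphic to $K_{3,3}$). A $k$-partite tournament is an orientation of a complete $k$-partite graph with $k$ nonempty partite sets. The niche graph $\mathcal{N}(D)$ of a digraph $D$ has vertex set $V(D)$, and two distinct vertices are adjacent iff they have a common out-neighbor in $D$ or a common in-neighbor in $D$. The pair $(G,k)$ is niche-realizable if $G$ is isomorphic to the niche graph of some $k$-partite tournament. -}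

module Defs where

open import Level using (0ℓ)
open import Data.Nat using (ℕ; zero; suc; _∸_)
open import Data.Fin using (Fin; toℕ)
open import Data.Product using (Σ; ∃; _×_; _,_; proj₁; proj₂)
open import Data.Sum using (_⊎_)
open import Data.List using (List; []; _∷_)
open import Data.List.Relation.Unary.Any using (Any)
open import Relation.Nullary using (¬_)
open import Relation.Binary.PropositionalEquality using (_≡_)
open import Function.Bundles using (_↔_; Inverse)

record Graph (n : ℕ) : Set₁ where
  field
    Adj : Fin n → Fin n → Set
open Graph public

record IsSimple {n : ℕ} (G : Graph n) : Set where
  field
    sym     : ∀ u v → Adj G u v → Adj G v u
    irrefl  : ∀ u → ¬ Adj G u u

data Reach {n : ℕ} (G : Graph n) : Fin n → Fin n → Set where
  here : ∀ {u} → Reach G u u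
  step : ∀ {u v w} → Adj G u v → Reach G v w → Reach G u w

Connected : {n : ℕ} → Graph n → Set
Connected {n} G = ∀ (u v : Fin n) → Reach G u v

TriangleFree : {n : ℕ} → Graph n → Set
TriangleFree {n} G = ∀ (a b c : Fin n) → ¬ (Adj G a b × Adj G b c × Adj G a c)

_≅_ : {n m : ℕ} → Graph n → Graph m → Set
_≅_ {n} {m} G H = Σ (Fin n ↔ Fin m) λ f →
  ∀ (u v : Fin n) → (Adj G u v → Adj H (Inverse.to f u) (Inverse.to f v))
                  × (Adj H (Inverse.to f u) (Inverse.to f v) → Adj G u v)

fromEdges : (n : ℕ) → List (ℕ × ℕ) → Graph n
fromEdges n es = record { Adj = λ u v → Any (λ e →
  (toℕ u ≡ proj₁ e × toℕ v ≡ proj₂ e) ⊎ (toℕ v ≡ proj₁ e × toℕ u ≡ proj₂ e)) es }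

Path : (m : ℕ) → Graph m
Path m = record { Adj = λ u v → (toℕ v ≡ suc (toℕ u)) ⊎ (toℕ u ≡ suc (toℕ v)) }

Cycle : (m : ℕ) → Graph m
Cycle m = record { Adj = λ u v → (toℕ v ≡ suc (toℕ u)) ⊎ (toℕ u ≡ suc (toℕ v))
                       ⊎ (toℕ u ≡ 0 × toℕ v ≡ m ∸ 1) ⊎ (toℕ v ≡ 0 × toℕ u ≡ m ∸ 1) }

-- G₄ : a,b,c,d,e = 0..4 ; edges ab,ad,bc,cd,de,eb  (≅ K_{2,3})
G₄ : Graph 5
G₄ = fromEdges 5 ((0 , 1) ∷ (0 , 3) ∷ (1 , 2) ∷ (2 , 3) ∷ (3 , 4) ∷ (4 , 1) ∷ [])

-- G₅ : x₁..x₆ = 0..5 ; 6-cycle plus the three long diagonals (≅ K_{3,3})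
G₅ : Graph 6
G₅ = fromEdges 6 ((0 , 1) ∷ (1 , 2) ∷ (2 , 3) ∷ (3 , 4) ∷ (4 , 5) ∷ (5 , 0)
                 ∷ (0 , 3) ∷ (1 , 4) ∷ (2 , 5) ∷ [])

-- A k-partite tournament on vertex set Fin n: an orientation (arc relation Arc)
-- of the complete k-partite graph whose partite sets are the fibres of part,
-- all k of them nonempty.
record MultipartiteTournament (n k : ℕ) : Set₁ where
  field
    part     : Fin n → Fin k
    nonempty : ∀ (i : Fin k) → ∃ λ v → part v ≡ i
    Arc      : Fin n → Fin n → Set
    arc-between : ∀ u v → Arc u v → ¬ (part u ≡ part v)
    complete : ∀ u v → ¬ (part u ≡ part v) → Arc u v ⊎ Arc v u
    antisym  : ∀ u v → Arc u v → ¬ Arc v u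

NicheGraph : {n k : ℕ} → MultipartiteTournament n k → Graph n
NicheGraph {n} D = record { Adj = λ u v → ¬ (u ≡ v) ×
    ((∃ λ w → Arc u w × Arc v w) ⊎ (∃ λ w → Arc w u × Arc w v)) }
  where open MultipartiteTournament D

NicheRealizable : {n : ℕ} → Graph n → ℕ → Set₁
NicheRealizable {n} G k = Σ (MultipartiteTournament n k) λ D → G ≅ NicheGraph D

-- Describe a k-partite tournament by the link of every pair of vertices: an arc one way,
-- an arc the other way, or the same part. If its niche graph is triangle-free then no vertex
-- has three in-neighbours or three out-neighbours (they would be pairwise niche-adjacent),
-- and "same part" is transitive. These local constraints prune the link patterns enough for
-- an exhaustive search, run by normalisation. On seven vertices, three of them in distinct
-- parts, no pattern survives; restricting to seven such vertices shows that a realizable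
-- graph has at most six vertices. On three to six vertices every surviving pattern gives a
-- niche graph with a triangle, or disconnected, or with fewer than three parts, or isomorphic
-- to a listed graph with the listed number of parts. Explicit tournaments realize the list.

module Submission where

open import Defs
open import Data.Nat using (ℕ; zero; suc; _+_; _∸_; _<_; _≤_; s≤s; _≡ᵇ_; _<ᵇ_)
open import Data.Nat.Properties using (≤-antisym; <⇒≱; m≤m+n; ≡ᵇ⇒≡; ≡⇒≡ᵇ; <ᵇ⇒<)
open import Data.Bool using (Bool; true; false; _∧_; _∨_; not; if_then_else_; T)
open import Data.Bool.Properties using (T-≡; T-∧; T-∨)
open import Data.Unit using (tt)
open import Data.Empty using (⊥; ⊥-elim)
open import Data.Fin using (Fin; zero; suc; toℕ; #_; _↑ˡ_)
import Data.Fin as F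
open import Data.Fin.Properties using (injective⇒≤; ↑ˡ-injective)
open import Data.Fin.Permutation using (↔⇒≡)
open import Data.Fin.Permutation.Components using (transpose; transpose-inverse)
open import Data.List using (List; []; _∷_; _++_; _ʳ++_; length; allFin; concatMap)
open import Data.Bool.ListAction using (any)
import Data.List as List
open import Data.List.Relation.Unary.Any using (Any; here; there)
import Data.List.Relation.Unary.Any as Any
open import Data.List.Relation.Unary.Any.Properties using (any⁻; any⁺)
open import Data.List.Relation.Unary.All using (All; []; _∷_)
open import Data.Maybe using (Maybe; just; nothing; fromMaybe)
open import Data.Vec using (Vec; tabulate; lookup; []; _∷_)
open import Data.Vec.Properties using (lookup∘tabulate)
open import Data.Product using (Σ; ∃; _×_; _,_; proj₁; proj₂; map₂)
open import Data.Sum using (_⊎_; inj₁; inj₂; [_,_]′)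
open import Function using (_∘_)
open import Function.Bundles using (_⇔_; mk⇔; Equivalence; Inverse; mk↔ₛ′)
open import Function.Definitions using (Injective)
open import Relation.Nullary using (¬_; Dec; yes; no)
open import Relation.Nullary.Decidable using (dec-true; dec-false)
open import Relation.Binary.PropositionalEquality
  using (_≡_; _≢_; refl; sym; trans; cong; subst; subst₂; module ≡-Reasoning)

module _ {a b : Bool} where

  T-∧ˡ : T (a ∧ b) → T a
  T-∧ˡ = proj₁ ∘ Equivalence.to T-∧

  T-∧ʳ : T (a ∧ b) → T b
  T-∧ʳ = proj₂ ∘ Equivalence.to T-∧

  T-∧⁺ : T a → T b → T (a ∧ b)
  T-∧⁺ x y = Equivalence.from T-∧ (x , y)

  T-∨⁻ : T (a ∨ b) → T a ⊎ T b
  T-∨⁻ = Equivalence.to T-∨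

  T-∨ˡ : T a → T (a ∨ b)
  T-∨ˡ = Equivalence.from T-∨ ∘ inj₁

  T-∨ʳ : T b → T (a ∨ b)
  T-∨ʳ = Equivalence.from T-∨ ∘ inj₂

T-not⁻ : ∀ {a} → T (not a) → ¬ T a
T-not⁻ {false} _ ()

T-not⁺ : ∀ {a} → ¬ T a → T (not a)
T-not⁺ {false} _ = tt
T-not⁺ {true}  h = h tt

≡true⇒T : ∀ {a} → a ≡ true → T a
≡true⇒T = Equivalence.from T-≡

_⇔ᵇ_ : Bool → Bool → Bool
true  ⇔ᵇ b = b
false ⇔ᵇ b = not b

T-⇔ᵇ : ∀ {a b} → T (a ⇔ᵇ b) → a ≡ b
T-⇔ᵇ {true}  {true}  _ = refl
T-⇔ᵇ {false} {false} _ = refl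

_≟ᵇ_ : ∀ {n} → Fin n → Fin n → Bool
zero  ≟ᵇ zero  = true
zero  ≟ᵇ suc _ = false
suc _ ≟ᵇ zero  = false
suc a ≟ᵇ suc b = a ≟ᵇ b

≟ᵇ⇒≡ : ∀ {n} {a b : Fin n} → T (a ≟ᵇ b) → a ≡ b
≟ᵇ⇒≡ {a = zero}  {zero}  _ = refl
≟ᵇ⇒≡ {a = suc a} {suc b} t = cong suc (≟ᵇ⇒≡ t)

≟ᵇ-refl : ∀ {n} (a : Fin n) → T (a ≟ᵇ a)
≟ᵇ-refl zero    = tt
≟ᵇ-refl (suc a) = ≟ᵇ-refl a

≢ᵇ⇒≢ : ∀ {n} {a b : Fin n} → T (not (a ≟ᵇ b)) → a ≢ b
≢ᵇ⇒≢ {a = a} t refl = T-not⁻ t (≟ᵇ-refl a)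

allᶠ : ∀ n → (Fin n → Bool) → Bool
allᶠ zero    p = true
allᶠ (suc n) p = p zero ∧ allᶠ n (λ i → p (suc i))

anyᶠ : ∀ n → (Fin n → Bool) → Bool
anyᶠ zero    p = false
anyᶠ (suc n) p = p zero ∨ anyᶠ n (λ i → p (suc i))

allᶠ⇒∀ : ∀ {n} {p : Fin n → Bool} → T (allᶠ n p) → ∀ i → T (p i)
allᶠ⇒∀ {suc n} t zero    = T-∧ˡ t
allᶠ⇒∀ {suc n} {p} t (suc i) = allᶠ⇒∀ (T-∧ʳ {p zero} t) i

anyᶠ⇒∃ : ∀ {n} {p : Fin n → Bool} → T (anyᶠ n p) → ∃ λ i → T (p i)
anyᶠ⇒∃ {suc n} {p} t with T-∨⁻ {p zero} t
... | inj₁ p0 = zero , p0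
... | inj₂ ps with anyᶠ⇒∃ ps
...   | i , pi = suc i , pi

∃⇒anyᶠ : ∀ {n} {p : Fin n → Bool} i → T (p i) → T (anyᶠ n p)
∃⇒anyᶠ {suc n} zero    t = T-∨ˡ t
∃⇒anyᶠ {suc n} {p} (suc i) t = T-∨ʳ {p zero} (∃⇒anyᶠ i t)

Rel : ℕ → Set
Rel n = Fin n → Fin n → Bool

nicheᵇ : ∀ {n} → Rel n → Rel n
nicheᵇ {n} arc u v = not (u ≟ᵇ v) ∧ anyᶠ n (λ w → (arc u w ∧ arc v w) ∨ (arc w u ∧ arc w v))

sameᵇ : ∀ {n} → Rel n → Rel n
sameᵇ arc u v = not (arc u v) ∧ not (arc v u)

tabulateRel : ∀ {n} → Rel n → Vec (Vec Bool n) n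
tabulateRel r = tabulate (λ u → tabulate (r u))

lookupRel : ∀ {n} → Vec (Vec Bool n) n → Rel n
lookupRel m u v = lookup (lookup m u) v

lookup-tabulateRel : ∀ {n} (r : Rel n) u v → lookupRel (tabulateRel r) u v ≡ r u v
lookup-tabulateRel r u v =
  trans (cong (λ row → lookup row v) (lookup∘tabulate (λ u → tabulate (r u)) u))
        (lookup∘tabulate (r u) v)

≅-sym : ∀ {n m} {G : Graph n} {H : Graph m} → G ≅ H → H ≅ G
≅-sym {H = H} (φ , φ-adj) =
  mk↔ₛ′ from to strictlyInverseʳ strictlyInverseˡ ,
  λ x y → (λ a → proj₂ (φ-adj _ _) (subst₂ (Adj H) (sym (strictlyInverseˡ x)) (sym (strictlyInverseˡ y)) a))
        , (λ a → subst₂ (Adj H) (strictlyInverseˡ x) (strictlyInverseˡ y) (proj₁ (φ-adj _ _) a))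
  where open Inverse φ

≅-trans : ∀ {n m p} {G : Graph n} {K : Graph m} {H : Graph p} → G ≅ K → K ≅ H → G ≅ H
≅-trans (φ , φ-adj) (ψ , ψ-adj) =
  mk↔ₛ′ (Inverse.to ψ ∘ Inverse.to φ) (Inverse.from φ ∘ Inverse.from ψ)
    (λ x → trans (cong (Inverse.to ψ) (Inverse.strictlyInverseˡ φ _)) (Inverse.strictlyInverseˡ ψ x))
    (λ u → trans (cong (Inverse.from φ) (Inverse.strictlyInverseʳ ψ _)) (Inverse.strictlyInverseʳ φ u)) ,
  λ u v → (proj₁ (ψ-adj _ _) ∘ proj₁ (φ-adj u v)) , (proj₂ (φ-adj u v) ∘ proj₂ (ψ-adj _ _))

TriangleFree-resp-≅ : ∀ {n m} {G : Graph n} {H : Graph m} → G ≅ H → TriangleFree G → TriangleFree H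
TriangleFree-resp-≅ G≅H tf a b c (ab , bc , ac) with ≅-sym G≅H
... | _ , adj = tf _ _ _ (proj₁ (adj a b) ab , proj₁ (adj b c) bc , proj₁ (adj a c) ac)

Reach-map : ∀ {n m} {G : Graph n} {H : Graph m} (φ : Fin n → Fin m) →
  (∀ u v → Adj G u v → Adj H (φ u) (φ v)) → ∀ {u v} → Reach G u v → Reach H (φ u) (φ v)
Reach-map φ hom here       = here
Reach-map φ hom (step a r) = step (hom _ _ a) (Reach-map φ hom r)

Connected-resp-≅ : ∀ {n m} {G : Graph n} {H : Graph m} → G ≅ H → Connected G → Connected H
Connected-resp-≅ {H = H} (φ , φ-adj) conn x y =
  subst₂ (Reach H) (strictlyInverseˡ x) (strictlyInverseˡ y)
    (Reach-map to (λ u v → proj₁ (φ-adj u v)) (conn (from x) (from y)))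
  where open Inverse φ

NicheRealizable-resp-≅ : ∀ {n m k} {G : Graph n} {H : Graph m} → G ≅ H →
  NicheRealizable H k → NicheRealizable G k
NicheRealizable-resp-≅ G≅H (D , H≅N) with ↔⇒≡ (proj₁ G≅H)
... | refl = D , ≅-trans {H = NicheGraph D} G≅H H≅N

data Link : Set where
  forward backward same : Link

reverse : Link → Link
reverse forward  = backward
reverse backward = forward
reverse same     = same

isForward isBackward isSame : Link → Bool
isForward forward = true
isForward _       = false
isBackward backward = true
isBackward _        = false
isSame same = true
isSame _    = false

isForward⇒≡ : ∀ {x} → T (isForward x) → x ≡ forward
isForward⇒≡ {forward} _ = refl

isBackward⇒≡ : ∀ {x} → T (isBackward x) → x ≡ backward
isBackward⇒≡ {backward} _ = refl

isSame⇒≡ : ∀ {x} → T (isSame x) → x ≡ same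
isSame⇒≡ {same} _ = refl

record LinkPattern (n : ℕ) : Set where
  field
    link         : Fin n → Fin n → Link
    link-reverse : ∀ u v → link v u ≡ reverse (link u v)
    same-trans   : ∀ u v w → link u v ≡ same → link v w ≡ same → link u w ≡ same
    in-degree≤2  : ∀ w a b c → a ≢ b → a ≢ c → b ≢ c →
                   link a w ≡ forward → link b w ≡ forward → link c w ≡ forward → ⊥
    out-degree≤2 : ∀ w a b c → a ≢ b → a ≢ c → b ≢ c →
                   link w a ≡ forward → link w b ≡ forward → link w c ≡ forward → ⊥

  same-sym : ∀ {u v} → link u v ≡ same → link v u ≡ same
  same-sym {u} {v} e = trans (link-reverse u v) (cong reverse e)

  link-refl : ∀ u → link u u ≡ same
  link-refl u = self-reverse (link u u) (link-reverse u u)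
    where
    self-reverse : ∀ x → x ≡ reverse x → x ≡ same
    self-reverse same _ = refl

restrict : ∀ {m n} → LinkPattern n → (ι : Fin m → Fin n) → Injective _≡_ _≡_ ι → LinkPattern m
restrict P ι ι-inj = record
  { link         = λ u v → link (ι u) (ι v)
  ; link-reverse = λ u v → link-reverse (ι u) (ι v)
  ; same-trans   = λ u v w → same-trans (ι u) (ι v) (ι w)
  ; in-degree≤2  = λ w a b c ab ac bc → in-degree≤2 (ι w) (ι a) (ι b) (ι c) (ι≢ ab) (ι≢ ac) (ι≢ bc)
  ; out-degree≤2 = λ w a b c ab ac bc → out-degree≤2 (ι w) (ι a) (ι b) (ι c) (ι≢ ab) (ι≢ ac) (ι≢ bc)
  }
  where
  open LinkPattern P
  ι≢ : ∀ {x y} → x ≢ y → ι x ≢ ι y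
  ι≢ x≢y = x≢y ∘ ι-inj

module TournamentLinks {n k : ℕ} (D : MultipartiteTournament n k) where
  open MultipartiteTournament D

  arc? : ∀ u v → Dec (Arc u v)
  arc? u v with part u F.≟ part v
  ... | yes e  = no (λ a → arc-between u v a e)
  ... | no  ne = [ yes , no ∘ antisym v u ]′ (complete u v ne)

  part-≡ : ∀ u v → ¬ Arc u v → ¬ Arc v u → part u ≡ part v
  part-≡ u v ¬uv ¬vu with part u F.≟ part v
  ... | yes e  = e
  ... | no  ne = ⊥-elim ([ ¬uv , ¬vu ]′ (complete u v ne))

  linkOf : Fin n → Fin n → Link
  linkOf u v with arc? u v | arc? v u
  ... | yes _ | _     = forward
  ... | no _  | yes _ = backward
  ... | no _  | no _  = same

  linkOf-forward : ∀ u v → linkOf u v ≡ forward → Arc u v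
  linkOf-forward u v with arc? u v | arc? v u
  ... | yes uv | _     = λ _ → uv
  ... | no _   | yes _ = λ ()
  ... | no _   | no _  = λ ()

  forward-linkOf : ∀ u v → Arc u v → linkOf u v ≡ forward
  forward-linkOf u v uv with arc? u v | arc? v u
  ... | yes _  | _     = refl
  ... | no ¬uv | _     = ⊥-elim (¬uv uv)

  linkOf-same : ∀ u v → linkOf u v ≡ same → part u ≡ part v
  linkOf-same u v with arc? u v | arc? v u
  ... | yes _  | _      = λ ()
  ... | no _   | yes _  = λ ()
  ... | no ¬uv | no ¬vu = λ _ → part-≡ u v ¬uv ¬vu

  same-linkOf : ∀ u v → part u ≡ part v → linkOf u v ≡ same
  same-linkOf u v e with arc? u v | arc? v u
  ... | yes uv | _     = ⊥-elim (arc-between u v uv e)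
  ... | no _   | yes vu = ⊥-elim (arc-between v u vu (sym e))
  ... | no _   | no _  = refl

  linkOf-reverse : ∀ u v → linkOf v u ≡ reverse (linkOf u v)
  linkOf-reverse u v with arc? u v | arc? v u
  ... | yes uv | yes vu = ⊥-elim (antisym u v uv vu)
  ... | yes _  | no _   = refl
  ... | no _   | yes _  = refl
  ... | no _   | no _   = refl

  NG : Graph n
  NG = NicheGraph D

  linkPattern : TriangleFree NG → LinkPattern n
  linkPattern tf = record
    { link         = linkOf
    ; link-reverse = linkOf-reverse
    ; same-trans   = λ u v w uv vw → same-linkOf u w (trans (linkOf-same u v uv) (linkOf-same v w vw))
    ; in-degree≤2  = λ w a b c ab ac bc aw bw cw → tf a b c
        ( (ab , inj₁ (w , linkOf-forward a w aw , linkOf-forward b w bw))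
        , (bc , inj₁ (w , linkOf-forward b w bw , linkOf-forward c w cw))
        , (ac , inj₁ (w , linkOf-forward a w aw , linkOf-forward c w cw)))
    ; out-degree≤2 = λ w a b c ab ac bc wa wb wc → tf a b c
        ( (ab , inj₂ (w , linkOf-forward w a wa , linkOf-forward w b wb))
        , (bc , inj₂ (w , linkOf-forward w b wb , linkOf-forward w c wc))
        , (ac , inj₂ (w , linkOf-forward w a wa , linkOf-forward w c wc)))
    }

  module _ (arc : Rel n) (arc⇒Arc : ∀ u v → T (arc u v) → Arc u v)
                         (Arc⇒arc : ∀ u v → Arc u v → T (arc u v)) where

    nicheᵇ⇒Adj : ∀ u v → T (nicheᵇ arc u v) → Adj NG u v
    nicheᵇ⇒Adj u v t with anyᶠ⇒∃ (T-∧ʳ {not (u ≟ᵇ v)} t)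
    ... | w , c with T-∨⁻ {arc u w ∧ arc v w} c
    ...   | inj₁ out = ≢ᵇ⇒≢ (T-∧ˡ t) , inj₁ (w , arc⇒Arc _ _ (T-∧ˡ out) , arc⇒Arc _ _ (T-∧ʳ {arc u w} out))
    ...   | inj₂ in′ = ≢ᵇ⇒≢ (T-∧ˡ t) , inj₂ (w , arc⇒Arc _ _ (T-∧ˡ in′) , arc⇒Arc _ _ (T-∧ʳ {arc w u} in′))

    Adj⇒nicheᵇ : ∀ u v → Adj NG u v → T (nicheᵇ arc u v)
    Adj⇒nicheᵇ u v (u≢v , inj₁ (w , uw , vw)) =
      T-∧⁺ (T-not⁺ (u≢v ∘ ≟ᵇ⇒≡)) (∃⇒anyᶠ w (T-∨ˡ (T-∧⁺ (Arc⇒arc _ _ uw) (Arc⇒arc _ _ vw))))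
    Adj⇒nicheᵇ u v (u≢v , inj₂ (w , wu , wv)) =
      T-∧⁺ (T-not⁺ (u≢v ∘ ≟ᵇ⇒≡))
        (∃⇒anyᶠ w (T-∨ʳ {arc u w ∧ arc v w} (T-∧⁺ (Arc⇒arc _ _ wu) (Arc⇒arc _ _ wv))))

  sameᵇ⇒part-≡ : (arc : Rel n) → (∀ u v → Arc u v → T (arc u v)) →
    ∀ u v → T (sameᵇ arc u v) → part u ≡ part v
  sameᵇ⇒part-≡ arc Arc⇒arc u v t =
    part-≡ u v (T-not⁻ (T-∧ˡ t) ∘ Arc⇒arc u v) (T-not⁻ (T-∧ʳ {not (arc u v)} t) ∘ Arc⇒arc v u)

-- Pruned exhaustive search

data Entry (n : ℕ) : Set where
  entry : Fin n → Fin n → Link → Entry n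

Agrees : ∀ {n} → (Fin n → Fin n → Link) → Entry n → Set
Agrees f (entry u v x) = f u v ≡ x

labelled : ∀ {n} → (Fin n → Fin n → Link) → List (Fin n × Fin n) → List (Entry n)
labelled f []             = []
labelled f ((u , v) ∷ ps) = entry u v (f u v) ∷ labelled f ps

labelled-agrees : ∀ {n} (f : Fin n → Fin n → Link) ps {es} →
  All (Agrees f) es → All (Agrees f) (labelled f ps ʳ++ es)
labelled-agrees f []             ok = ok
labelled-agrees f ((u , v) ∷ ps) ok = labelled-agrees f ps (refl ∷ ok)

pairsBelow : ∀ {n} → List (Fin n) → Fin n → List (Fin n × Fin n)
pairsBelow []       j = []
pairsBelow (i ∷ is) j = if i ≟ᵇ j then [] else (i , j) ∷ pairsBelow is j

orderedPairs : ∀ n → List (Fin n × Fin n)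
orderedPairs n = concatMap (pairsBelow (allFin n)) (allFin n)

explore : ∀ {n} → (Entry n → List (Entry n) → Bool) → (List (Entry n) → Bool) →
  List (Fin n × Fin n) → List (Entry n) → Bool
explore bad leaf []             es = leaf es
explore bad leaf ((u , v) ∷ ps) es =
  (bad (entry u v forward)  es ∨ explore bad leaf ps (entry u v forward  ∷ es)) ∧
  (bad (entry u v backward) es ∨ explore bad leaf ps (entry u v backward ∷ es)) ∧
  (bad (entry u v same)     es ∨ explore bad leaf ps (entry u v same     ∷ es))

-- Opaque, so that typechecking the uses of a computed search result does not run the search again.
opaque
  Exhausts : ∀ {n} → (Entry n → List (Entry n) → Bool) → (List (Entry n) → Bool) → Set
  Exhausts {n} bad leaf = explore bad leaf (orderedPairs n) [] ≡ true

  Exhausts⇒T : ∀ {n} {bad : Entry n → List (Entry n) → Bool} {leaf} →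
    Exhausts bad leaf → T (explore bad leaf (orderedPairs n) [])
  Exhausts⇒T = ≡true⇒T

anyViolation : ∀ {n} → (Entry n → List (Entry n) → Bool) → List (Entry n) → Bool
anyViolation bad []       = false
anyViolation bad (e ∷ es) = bad e es ∨ anyViolation bad es

anyViolation-ʳ++ : ∀ {n} bad (qs : List (Entry n)) {es} →
  T (anyViolation bad es) → T (anyViolation bad (qs ʳ++ es))
anyViolation-ʳ++ bad []       t = t
anyViolation-ʳ++ bad (q ∷ qs) {es} t = anyViolation-ʳ++ bad qs (T-∨ʳ {bad q es} t)

explore-sound : ∀ {n} bad leaf ps (es : List (Entry n)) → T (explore bad leaf ps es) →
  ∀ f → T (anyViolation bad (labelled f ps ʳ++ es)) ⊎ T (leaf (labelled f ps ʳ++ es))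
explore-sound bad leaf []             es t f = inj₂ t
explore-sound bad leaf ((u , v) ∷ ps) es t f with T-∨⁻ {bad (entry u v (f u v)) es} (chosen (f u v))
  where
  chosen : ∀ x → T (bad (entry u v x) es ∨ explore bad leaf ps (entry u v x ∷ es))
  chosen forward  = T-∧ˡ t
  chosen backward = T-∧ˡ (T-∧ʳ {bad (entry u v forward) es ∨ explore bad leaf ps (entry u v forward ∷ es)} t)
  chosen same     = T-∧ʳ (T-∧ʳ {bad (entry u v forward) es ∨ explore bad leaf ps (entry u v forward ∷ es)} t)
... | inj₁ b  = inj₁ (anyViolation-ʳ++ bad (labelled f ps) (T-∨ˡ b))
... | inj₂ ok = explore-sound bad leaf ps _ ok f

lookupLink : ∀ {n} → List (Entry n) → Fin n → Fin n → Maybe Link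
lookupLink []                 u v = nothing
lookupLink (entry a b x ∷ es) u v =
  if (a ≟ᵇ u) ∧ (b ≟ᵇ v) then just x
  else if (a ≟ᵇ v) ∧ (b ≟ᵇ u) then just (reverse x)
  else lookupLink es u v

inNeighbours outNeighbours : ∀ {n} → Fin n → List (Entry n) → List (Fin n)
inNeighbours v [] = []
inNeighbours v (entry a b x ∷ es) =
  if (b ≟ᵇ v) ∧ isForward x then a ∷ inNeighbours v es
  else if (a ≟ᵇ v) ∧ isBackward x then b ∷ inNeighbours v es
  else inNeighbours v es
outNeighbours v [] = []
outNeighbours v (entry a b x ∷ es) =
  if (a ≟ᵇ v) ∧ isForward x then b ∷ outNeighbours v es
  else if (b ≟ᵇ v) ∧ isBackward x then a ∷ outNeighbours v es
  else outNeighbours v es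

oneBesides : ∀ {n} → Fin n → Fin n → List (Fin n) → Bool
oneBesides u a []      = false
oneBesides u a (b ∷ l) = (not (u ≟ᵇ b) ∧ not (a ≟ᵇ b)) ∨ oneBesides u a l

twoBesides : ∀ {n} → Fin n → List (Fin n) → Bool
twoBesides u []      = false
twoBesides u (a ∷ l) = (not (u ≟ᵇ a) ∧ oneBesides u a l) ∨ twoBesides u l

exactlyTwoSame : Link → Link → Link → Bool
exactlyTwoSame same same forward  = true
exactlyTwoSame same same backward = true
exactlyTwoSame same forward  same = true
exactlyTwoSame same backward same = true
exactlyTwoSame forward  same same = true
exactlyTwoSame backward same same = true
exactlyTwoSame _ _ _ = false

intransitive : Link → Maybe Link → Maybe Link → Bool
intransitive x (just p) (just q) = exactlyTwoSame x p q
intransitive x _        _        = false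

breaksTransitivity : ∀ {n} → List (Fin n) → Fin n → Fin n → Link → List (Entry n) → Bool
breaksTransitivity []       u v x es = false
breaksTransitivity (w ∷ ws) u v x es =
  intransitive x (lookupLink es u w) (lookupLink es v w) ∨ breaksTransitivity ws u v x es

breaksDegree : ∀ {n} → Fin n → Fin n → Link → List (Entry n) → Bool
breaksDegree u v forward  es = twoBesides u (inNeighbours v es) ∨ twoBesides v (outNeighbours u es)
breaksDegree u v backward es = twoBesides v (inNeighbours u es) ∨ twoBesides u (outNeighbours v es)
breaksDegree u v same     es = false

violates : ∀ {n} → Entry n → List (Entry n) → Bool
violates {n} (entry u v x) es = breaksDegree u v x es ∨ breaksTransitivity (allFin n) u v x es

oneBesides-sound : ∀ {n} {P : Fin n → Set} {u a l} → All P l → T (oneBesides u a l) →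
  ∃ λ b → P b × u ≢ b × a ≢ b
oneBesides-sound {u = u} {a} {b ∷ l} (pb ∷ ps) t with T-∨⁻ {not (u ≟ᵇ b) ∧ not (a ≟ᵇ b)} t
... | inj₁ here′ = b , pb , ≢ᵇ⇒≢ (T-∧ˡ here′) , ≢ᵇ⇒≢ (T-∧ʳ {not (u ≟ᵇ b)} here′)
... | inj₂ later = oneBesides-sound ps later

twoBesides-sound : ∀ {n} {P : Fin n → Set} {u l} → All P l → T (twoBesides u l) →
  ∃ λ a → ∃ λ b → P a × P b × u ≢ a × u ≢ b × a ≢ b
twoBesides-sound {u = u} {a ∷ l} (pa ∷ ps) t with T-∨⁻ {not (u ≟ᵇ a) ∧ oneBesides u a l} t
... | inj₂ later = twoBesides-sound ps later
... | inj₁ here′ with oneBesides-sound ps (T-∧ʳ {not (u ≟ᵇ a)} here′)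
...   | b , pb , u≢b , a≢b = a , b , pa , pb , ≢ᵇ⇒≢ (T-∧ˡ here′) , u≢b , a≢b

module _ {n : ℕ} (P : LinkPattern n) where
  open LinkPattern P

  lookupLink-sound : ∀ {es} → All (Agrees link) es → ∀ {u v x} → lookupLink es u v ≡ just x → link u v ≡ x
  lookupLink-sound {entry a b x ∷ es} (ok ∷ oks) {u} {v} e with (a ≟ᵇ u) ∧ (b ≟ᵇ v) in c₁
  ... | true with ≟ᵇ⇒≡ {a = a} (T-∧ˡ (≡true⇒T c₁)) | ≟ᵇ⇒≡ {a = b} (T-∧ʳ {a ≟ᵇ u} (≡true⇒T c₁)) | e
  ...   | refl | refl | refl = ok
  lookupLink-sound {entry a b x ∷ es} (ok ∷ oks) {u} {v} e | false with (a ≟ᵇ v) ∧ (b ≟ᵇ u) in c₂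
  ... | true with ≟ᵇ⇒≡ {a = a} (T-∧ˡ (≡true⇒T c₂)) | ≟ᵇ⇒≡ {a = b} (T-∧ʳ {a ≟ᵇ v} (≡true⇒T c₂)) | e
  ...   | refl | refl | refl = trans (link-reverse v u) (cong reverse ok)
  lookupLink-sound {entry a b x ∷ es} (ok ∷ oks) {u} {v} e | false | false = lookupLink-sound oks e

  inNeighbours-sound : ∀ {es} → All (Agrees link) es → ∀ v → All (λ a → link a v ≡ forward) (inNeighbours v es)
  inNeighbours-sound [] v = []
  inNeighbours-sound {entry a b x ∷ es} (ok ∷ oks) v with (b ≟ᵇ v) ∧ isForward x in c₁
  ... | true with ≟ᵇ⇒≡ {a = b} (T-∧ˡ (≡true⇒T c₁)) | isForward⇒≡ {x} (T-∧ʳ {b ≟ᵇ v} (≡true⇒T c₁))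
  ...   | refl | refl = ok ∷ inNeighbours-sound oks v
  inNeighbours-sound {entry a b x ∷ es} (ok ∷ oks) v | false with (a ≟ᵇ v) ∧ isBackward x in c₂
  ... | true with ≟ᵇ⇒≡ {a = a} (T-∧ˡ (≡true⇒T c₂)) | isBackward⇒≡ {x} (T-∧ʳ {a ≟ᵇ v} (≡true⇒T c₂))
  ...   | refl | refl = trans (link-reverse v b) (cong reverse ok) ∷ inNeighbours-sound oks v
  inNeighbours-sound {entry a b x ∷ es} (ok ∷ oks) v | false | false = inNeighbours-sound oks v

  outNeighbours-sound : ∀ {es} → All (Agrees link) es → ∀ v → All (λ a → link v a ≡ forward) (outNeighbours v es)
  outNeighbours-sound [] v = []
  outNeighbours-sound {entry a b x ∷ es} (ok ∷ oks) v with (a ≟ᵇ v) ∧ isForward x in c₁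
  ... | true with ≟ᵇ⇒≡ {a = a} (T-∧ˡ (≡true⇒T c₁)) | isForward⇒≡ {x} (T-∧ʳ {a ≟ᵇ v} (≡true⇒T c₁))
  ...   | refl | refl = ok ∷ outNeighbours-sound oks v
  outNeighbours-sound {entry a b x ∷ es} (ok ∷ oks) v | false with (b ≟ᵇ v) ∧ isBackward x in c₂
  ... | true with ≟ᵇ⇒≡ {a = b} (T-∧ˡ (≡true⇒T c₂)) | isBackward⇒≡ {x} (T-∧ʳ {b ≟ᵇ v} (≡true⇒T c₂))
  ...   | refl | refl = trans (link-reverse a v) (cong reverse ok) ∷ outNeighbours-sound oks v
  outNeighbours-sound {entry a b x ∷ es} (ok ∷ oks) v | false | false = outNeighbours-sound oks v

  breaksDegree-sound : ∀ {es} → All (Agrees link) es → ∀ u v → ¬ T (breaksDegree u v (link u v) es)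
  breaksDegree-sound {es} oks u v t with link u v in uv
  ... | forward with T-∨⁻ {twoBesides u (inNeighbours v es)} t
  ...   | inj₁ i with twoBesides-sound (inNeighbours-sound oks v) i
  ...     | a , b , av , bv , u≢a , u≢b , a≢b = in-degree≤2 v u a b u≢a u≢b a≢b uv av bv
  breaksDegree-sound {es} oks u v t | forward | inj₂ o with twoBesides-sound (outNeighbours-sound oks u) o
  ...     | a , b , ua , ub , v≢a , v≢b , a≢b = out-degree≤2 u v a b v≢a v≢b a≢b uv ua ub
  breaksDegree-sound {es} oks u v t | backward with T-∨⁻ {twoBesides v (inNeighbours u es)} t
  ...   | inj₁ i with twoBesides-sound (inNeighbours-sound oks u) i
  ...     | a , b , au , bu , v≢a , v≢b , a≢b =
    in-degree≤2 u v a b v≢a v≢b a≢b (trans (link-reverse u v) (cong reverse uv)) au bu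
  breaksDegree-sound {es} oks u v t | backward | inj₂ o with twoBesides-sound (outNeighbours-sound oks v) o
  ...     | a , b , va , vb , u≢a , u≢b , a≢b =
    out-degree≤2 v u a b u≢a u≢b a≢b (trans (link-reverse u v) (cong reverse uv)) va vb

  exactlyTwoSame-impossible : ∀ {u v w p q} → link u w ≡ p → link v w ≡ q → ¬ T (exactlyTwoSame (link u v) p q)
  exactlyTwoSame-impossible {u} {v} {w} = go refl
    where
    go : ∀ {x p q} → link u v ≡ x → link u w ≡ p → link v w ≡ q → ¬ T (exactlyTwoSame x p q)
    go {same}     {same}     {forward}  uv uw vw _ with () ← trans (sym (same-trans v u w (same-sym uv) uw)) vw
    go {same}     {same}     {backward} uv uw vw _ with () ← trans (sym (same-trans v u w (same-sym uv) uw)) vw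
    go {same}     {forward}  {same}     uv uw vw _ with () ← trans (sym (same-trans u v w uv vw)) uw
    go {same}     {backward} {same}     uv uw vw _ with () ← trans (sym (same-trans u v w uv vw)) uw
    go {forward}  {same}     {same}     uv uw vw _ with () ← trans (sym (same-trans u w v uw (same-sym vw))) uv
    go {backward} {same}     {same}     uv uw vw _ with () ← trans (sym (same-trans u w v uw (same-sym vw))) uv

  breaksTransitivity-sound : ∀ {es} → All (Agrees link) es → ∀ ws u v → ¬ T (breaksTransitivity ws u v (link u v) es)
  breaksTransitivity-sound {es} oks (w ∷ ws) u v t
    with T-∨⁻ {intransitive (link u v) (lookupLink es u w) (lookupLink es v w)} t
  ... | inj₂ later = breaksTransitivity-sound oks ws u v later
  ... | inj₁ now with lookupLink es u w in uw | lookupLink es v w in vw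
  ...   | just p | just q = exactlyTwoSame-impossible (lookupLink-sound oks uw) (lookupLink-sound oks vw) now

  violates-sound : ∀ {es} → All (Agrees link) es → ∀ u v → ¬ T (violates (entry u v (link u v)) es)
  violates-sound {es} oks u v t with T-∨⁻ {breaksDegree u v (link u v) es} t
  ... | inj₁ d = breaksDegree-sound oks u v d
  ... | inj₂ s = breaksTransitivity-sound oks (allFin n) u v s

noViolation : ∀ {n} (f : Fin n → Fin n → Link) bad →
  (∀ {es} → All (Agrees f) es → ∀ u v → ¬ T (bad (entry u v (f u v)) es)) →
  ∀ {es} → All (Agrees f) es → ¬ T (anyViolation bad es)
noViolation f bad bad-sound {entry u v x ∷ es} (refl ∷ oks) t with T-∨⁻ {bad (entry u v (f u v)) es} t
... | inj₁ b = bad-sound oks u v b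
... | inj₂ b = noViolation f bad bad-sound oks b

explore-refutes : ∀ {n} (f : Fin n → Fin n → Link) bad → Exhausts bad (λ _ → false) →
  (∀ {es} → All (Agrees f) es → ∀ u v → ¬ T (bad (entry u v (f u v)) es)) → ⊥
explore-refutes {n} f bad exhausted bad-sound =
  [ noViolation f bad bad-sound (labelled-agrees f (orderedPairs n) []) , (λ ()) ]′
    (explore-sound bad (λ _ → false) (orderedPairs n) [] (Exhausts⇒T exhausted) f)

hasTriangle : ∀ {n} → Rel n → Bool
hasTriangle {n} r = anyᶠ n λ u → anyᶠ n λ v → anyᶠ n λ w → r u v ∧ r v w ∧ r u w

Triangle : ∀ {n} → Rel n → Set
Triangle {n} r = ∃ λ u → ∃ λ v → ∃ λ w → T (r u v) × T (r v w) × T (r u w)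

hasTriangle-sound : ∀ {n} (r : Rel n) → T (hasTriangle r) → Triangle r
hasTriangle-sound r t with anyᶠ⇒∃ t
... | u , tu with anyᶠ⇒∃ tu
...   | v , tv with anyᶠ⇒∃ tv
...     | w , tw = u , v , w , T-∧ˡ tw , T-∧ˡ (T-∧ʳ {r u v} tw) , T-∧ʳ {r v w} (T-∧ʳ {r u v} tw)

expand : ∀ {n} → Rel n → Vec Bool n → Vec Bool n
expand {n} r s = tabulate (λ v → lookup s v ∨ anyᶠ n (λ u → lookup s u ∧ r u v))

expandTimes : ∀ {n} → ℕ → Rel n → Vec Bool n → Vec Bool n
expandTimes zero    r s = s
expandTimes (suc i) r s = expandTimes i r (expand r s)

separatedBy : ∀ {n} → Fin n → Rel n → (Fin n → Bool) → Bool
separatedBy {n} d r R =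
  R d ∧ (allᶠ n λ u → allᶠ n λ v → not (R u ∧ r u v) ∨ R v) ∧ anyᶠ n (λ v → not (R v))

separatedFrom : ∀ {n} → Fin n → Rel n → Bool
separatedFrom {n} d r = separatedBy d r (lookup (expandTimes n r (tabulate (_≟ᵇ_ d))))

Separated : ∀ {n} → Fin n → Rel n → Set
Separated {n} d r = ∃ λ (R : Fin n → Bool) →
  T (R d) × (∀ u v → T (R u) → T (r u v) → T (R v)) × ∃ λ v → ¬ T (R v)

separatedBy-sound : ∀ {n} d (r : Rel n) R → T (separatedBy d r R) → Separated d r
separatedBy-sound {n} d r R t = R , T-∧ˡ t , closed , outside
  where
  closed : ∀ u v → T (R u) → T (r u v) → T (R v)
  closed u v Ru ruv with T-∨⁻ {not (R u ∧ r u v)} (allᶠ⇒∀ (allᶠ⇒∀ (T-∧ˡ (T-∧ʳ {R d} t)) u) v)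
  ... | inj₁ x  = ⊥-elim (T-not⁻ x (T-∧⁺ Ru ruv))
  ... | inj₂ Rv = Rv
  outside : ∃ λ v → ¬ T (R v)
  outside with anyᶠ⇒∃ (T-∧ʳ {allᶠ n _} (T-∧ʳ {R d} t))
  ... | v , x = v , T-not⁻ x

separatedFrom-sound : ∀ {n} d (r : Rel n) → T (separatedFrom d r) → Separated d r
separatedFrom-sound {n} d r = separatedBy-sound d r (lookup (expandTimes n r (tabulate (_≟ᵇ_ d))))

Separated-¬Reach : ∀ {n} {G : Graph n} {d r} → (∀ u v → Adj G u v → T (r u v)) →
  Separated d r → ¬ (∀ v → Reach G d v)
Separated-¬Reach {G = G} {d} {r} Adj⇒r (R , Rd , closed , v , ¬Rv) reach = ¬Rv (follow (reach v) Rd)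
  where
  follow : ∀ {u w} → Reach G u w → T (R u) → T (R w)
  follow here       Ru = Ru
  follow (step a p) Ru = follow p (closed _ _ Ru (Adj⇒r _ _ a))

partRepresentatives : ∀ {n} → Rel n → List (Fin n) → List (Fin n) → List (Fin n)
partRepresentatives arc reps []       = reps
partRepresentatives arc reps (v ∷ vs) =
  if any (sameᵇ arc v) reps then partRepresentatives arc reps vs
  else partRepresentatives arc (reps ++ v ∷ []) vs

representsParts : ∀ {n} → Rel n → (m : ℕ) → (Fin m → Fin n) → Bool
representsParts {n} arc m rep =
  (allᶠ m λ i → allᶠ m λ j → (i ≟ᵇ j) ∨ arc (rep i) (rep j) ∨ arc (rep j) (rep i)) ∧
  (allᶠ n λ v → anyᶠ m λ i → sameᵇ arc v (rep i))

record Representatives {n : ℕ} (arc : Rel n) (m : ℕ) : Set where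
  field
    rep        : Fin m → Fin n
    rep-apart  : ∀ i j → i ≢ j → T (arc (rep i) (rep j)) ⊎ T (arc (rep j) (rep i))
    rep-covers : ∀ v → ∃ λ i → T (sameᵇ arc v (rep i))

representsParts-sound : ∀ {n} (arc : Rel n) m rep → T (representsParts arc m rep) → Representatives arc m
representsParts-sound arc m rep t = record { rep = rep ; rep-apart = apart ; rep-covers = covers }
  where
  apart : ∀ i j → i ≢ j → T (arc (rep i) (rep j)) ⊎ T (arc (rep j) (rep i))
  apart i j i≢j with T-∨⁻ {i ≟ᵇ j} (allᶠ⇒∀ (allᶠ⇒∀ (T-∧ˡ t) i) j)
  ... | inj₁ i≡j = ⊥-elim (i≢j (≟ᵇ⇒≡ i≡j))
  ... | inj₂ a   = T-∨⁻ a
  covers : ∀ v → ∃ λ i → T (sameᵇ arc v (rep i))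
  covers v = anyᶠ⇒∃ (allᶠ⇒∀ (T-∧ʳ {allᶠ m _} t) v)

firstJust : ∀ {n} {X : Set} → List (Fin n) → (Fin n → Maybe X) → Maybe X
firstJust []       g = nothing
firstJust (y ∷ ys) g with g y
... | just x  = just x
... | nothing = firstJust ys g

consistent : ∀ {n} → Rel n → Rel n → Fin n → Fin n → List (Fin n × Fin n) → Bool
consistent r s u y []             = true
consistent r s u y ((a , b) ∷ as) = not (y ≟ᵇ b) ∧ (r u a ⇔ᵇ s y b) ∧ consistent r s u y as

findIsomorphism : ∀ {n} → Rel n → Rel n → List (Fin n) → List (Fin n × Fin n) → Maybe (List (Fin n × Fin n))
findIsomorphism {n} r s []       as = just as
findIsomorphism {n} r s (u ∷ us) as = firstJust (allFin n) λ y →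
  if consistent r s u y as then findIsomorphism r s us ((u , y) ∷ as) else nothing

applyPairs applyPairs⁻¹ : ∀ {n} → Fin n → List (Fin n × Fin n) → Fin n → Fin n
applyPairs d []             u = d
applyPairs d ((a , b) ∷ as) u = if a ≟ᵇ u then b else applyPairs d as u
applyPairs⁻¹ d []             u = d
applyPairs⁻¹ d ((a , b) ∷ as) u = if b ≟ᵇ u then a else applyPairs⁻¹ d as u

isIsomorphism : ∀ {n} → Rel n → Rel n → (Fin n → Fin n) → (Fin n → Fin n) → Bool
isIsomorphism {n} r s π ψ = (allᶠ n λ u → ψ (π u) ≟ᵇ u) ∧ (allᶠ n λ x → π (ψ x) ≟ᵇ x)
  ∧ (allᶠ n λ u → allᶠ n λ v → r u v ⇔ᵇ s (π u) (π v))

-- Soundness rests on the final isIsomorphism check alone; the default vertex d only fills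
-- the junk values of the partial maps proposed by the backtracking search.
isomorphicᵇ : ∀ {n} → Fin n → Rel n → Rel n → Bool
isomorphicᵇ {n} d r s with findIsomorphism r s (allFin n) []
... | nothing = false
... | just as = isIsomorphism r s (applyPairs d as) (applyPairs⁻¹ d as)

record Isoᵇ {n : ℕ} (r s : Rel n) : Set where
  field
    to        : Fin n → Fin n
    from      : Fin n → Fin n
    from∘to   : ∀ u → from (to u) ≡ u
    to∘from   : ∀ x → to (from x) ≡ x
    preserves : ∀ u v → r u v ≡ s (to u) (to v)

isIsomorphism-sound : ∀ {n} (r s : Rel n) π ψ → T (isIsomorphism r s π ψ) → Isoᵇ r s
isIsomorphism-sound {n} r s π ψ t = record
  { to = π ; from = ψ
  ; from∘to   = λ u → ≟ᵇ⇒≡ (allᶠ⇒∀ (T-∧ˡ t) u)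
  ; to∘from   = λ x → ≟ᵇ⇒≡ (allᶠ⇒∀ (T-∧ˡ (T-∧ʳ {allᶠ n _} t)) x)
  ; preserves = λ u v → T-⇔ᵇ (allᶠ⇒∀ (allᶠ⇒∀ (T-∧ʳ {allᶠ n _} (T-∧ʳ {allᶠ n _} t)) u) v)
  }

isomorphicᵇ-sound : ∀ {n} d (r s : Rel n) → T (isomorphicᵇ d r s) → Isoᵇ r s
isomorphicᵇ-sound {n} d r s t with findIsomorphism r s (allFin n) []
... | just as = isIsomorphism-sound r s _ _ t

Isoᵇ⇒≅ : ∀ {n} {G H : Graph n} {r s : Rel n} →
  (∀ u v → T (r u v) → Adj G u v) → (∀ u v → Adj G u v → T (r u v)) →
  (∀ u v → T (s u v) → Adj H u v) → (∀ u v → Adj H u v → T (s u v)) →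
  Isoᵇ r s → G ≅ H
Isoᵇ⇒≅ r⇒G G⇒r s⇒H H⇒s i = mk↔ₛ′ to from to∘from from∘to ,
  λ u v → (λ a → s⇒H _ _ (subst T (preserves u v) (G⇒r u v a)))
        , (λ a → r⇒G u v (subst T (sym (preserves u v)) (H⇒s _ _ a)))
  where open Isoᵇ i

record Candidate (n : ℕ) : Set₁ where
  field
    parts    : ℕ
    graph    : Graph n
    adjᵇ     : Rel n
    adjᵇ⇒Adj : ∀ u v → T (adjᵇ u v) → Adj graph u v
    Adj⇒adjᵇ : ∀ u v → Adj graph u v → T (adjᵇ u v)
open Candidate

matchesCandidate : ∀ {n} → Fin n → List (Candidate n) → Rel n → Rel n → List (Fin n) → Bool
matchesCandidate d cands arc niche reps =
  representsParts arc (length reps) (List.lookup reps) ∧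
  ((length reps <ᵇ 3) ∨ any (λ c → (parts c ≡ᵇ length reps) ∧ isomorphicᵇ d niche (adjᵇ c)) cands)

verdict : ∀ {n} → Fin n → List (Candidate n) → Rel n → Rel n → Bool
verdict {n} d cands arc niche =
  hasTriangle niche ∨ separatedFrom d niche ∨
  matchesCandidate d cands arc niche (partRepresentatives arc [] (allFin n))

linkAt : ∀ {n} → List (Entry n) → Fin n → Fin n → Link
linkAt es u v = fromMaybe same (lookupLink es u v)

-- Both relations are tabulated into vectors once per leaf, so that they are
-- not recomputed at every use during normalisation.
verdictᵛ : ∀ {n} → Fin n → List (Candidate n) → Vec (Vec Bool n) n → Vec (Vec Bool n) n → Bool
verdictᵛ d cands arcs niche = verdict d cands (lookupRel arcs) (lookupRel niche)

verdictArcsᵛ : ∀ {n} → Fin n → List (Candidate n) → Vec (Vec Bool n) n → Bool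
verdictArcsᵛ d cands arcs = verdictᵛ d cands arcs (tabulateRel (nicheᵇ (lookupRel arcs)))

leafVerdict : ∀ {n} → Fin n → List (Candidate n) → List (Entry n) → Bool
leafVerdict d cands es = verdictArcsᵛ d cands (tabulateRel (λ u v → isForward (linkAt es u v)))

record Matched {n : ℕ} (cands : List (Candidate n)) (arc niche : Rel n) : Set₁ where
  field
    count           : ℕ
    representatives : Representatives arc count
    few-or-matching : count < 3 ⊎ Any (λ c → parts c ≡ count × Isoᵇ niche (adjᵇ c)) cands

matchesCandidate-sound : ∀ {n} d cands (arc niche : Rel n) reps →
  T (matchesCandidate d cands arc niche reps) → Matched cands arc niche
matchesCandidate-sound d cands arc niche reps t = record
  { count           = length reps
  ; representatives = representsParts-sound arc (length reps) (List.lookup reps) (T-∧ˡ t)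
  ; few-or-matching = [ inj₁ ∘ <ᵇ⇒< (length reps) 3 , inj₂ ∘ Any.map (λ {c} → matching {c}) ∘ any⁻ _ cands ]′
                        (T-∨⁻ (T-∧ʳ {representsParts arc (length reps) (List.lookup reps)} t))
  }
  where
  matching : ∀ {c} → T ((parts c ≡ᵇ length reps) ∧ isomorphicᵇ d niche (adjᵇ c)) →
             parts c ≡ length reps × Isoᵇ niche (adjᵇ c)
  matching {c} t = ≡ᵇ⇒≡ _ _ (T-∧ˡ t) , isomorphicᵇ-sound d niche (adjᵇ c) (T-∧ʳ {parts c ≡ᵇ length reps} t)

verdict-sound : ∀ {n} d cands (arc niche : Rel n) → T (verdict d cands arc niche) →
  Triangle niche ⊎ Separated d niche ⊎ Matched cands arc niche
verdict-sound {n} d cands arc niche t with T-∨⁻ {hasTriangle niche} t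
... | inj₁ tri = inj₁ (hasTriangle-sound niche tri)
... | inj₂ t′ with T-∨⁻ {separatedFrom d niche} t′
...   | inj₁ sep = inj₂ (inj₁ (separatedFrom-sound d niche sep))
...   | inj₂ m   = inj₂ (inj₂ (matchesCandidate-sound d cands arc niche (partRepresentatives arc [] (allFin n)) m))

Covers : ∀ {n} → Fin n → Fin n → Fin n × Fin n → Set
Covers u v p = p ≡ (u , v) ⊎ p ≡ (v , u)

coversᵇ : ∀ {n} → Fin n → Fin n → Fin n × Fin n → Bool
coversᵇ u v (a , b) = ((a ≟ᵇ u) ∧ (b ≟ᵇ v)) ∨ ((a ≟ᵇ v) ∧ (b ≟ᵇ u))

coversᵇ-sound : ∀ {n} {u v : Fin n} p → T (coversᵇ u v p) → Covers u v p
coversᵇ-sound {u = u} {v} (a , b) t with T-∨⁻ {(a ≟ᵇ u) ∧ (b ≟ᵇ v)} t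
... | inj₁ x with ≟ᵇ⇒≡ {a = a} (T-∧ˡ x) | ≟ᵇ⇒≡ {a = b} (T-∧ʳ {a ≟ᵇ u} x)
...   | refl | refl = inj₁ refl
coversᵇ-sound {u = u} {v} (a , b) t | inj₂ y with ≟ᵇ⇒≡ {a = a} (T-∧ˡ y) | ≟ᵇ⇒≡ {a = b} (T-∧ʳ {a ≟ᵇ v} y)
...   | refl | refl = inj₂ refl

coversAllPairs : ℕ → Bool
coversAllPairs n = allᶠ n λ u → allᶠ n λ v → (u ≟ᵇ v) ∨ any (coversᵇ u v) (orderedPairs n)

coversAllPairs-sound : ∀ {n} → T (coversAllPairs n) → ∀ (u v : Fin n) → u ≡ v ⊎ Any (Covers u v) (orderedPairs n)
coversAllPairs-sound {n} t u v with T-∨⁻ {u ≟ᵇ v} (allᶠ⇒∀ (allᶠ⇒∀ t u) v)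
... | inj₁ u≡v = inj₁ (≟ᵇ⇒≡ u≡v)
... | inj₂ c   = inj₂ (Any.map (λ {p} → coversᵇ-sound p) (any⁻ _ _ c))

Mentions : ∀ {n} → Fin n → Fin n → Entry n → Set
Mentions u v (entry a b _) = (a ≡ u × b ≡ v) ⊎ (a ≡ v × b ≡ u)

Any-ʳ++⁺ʳ : ∀ {a p} {A : Set a} {P : A → Set p} (xs : List A) {ys} → Any P ys → Any P (xs ʳ++ ys)
Any-ʳ++⁺ʳ []       p = p
Any-ʳ++⁺ʳ (x ∷ xs) p = Any-ʳ++⁺ʳ xs (there p)

labelled-mentions : ∀ {n} (f : Fin n → Fin n → Link) {u v} ps es →
  Any (Covers u v) ps → Any (Mentions u v) (labelled f ps ʳ++ es)
labelled-mentions f (_ ∷ ps) es (here (inj₁ refl)) = Any-ʳ++⁺ʳ (labelled f ps) (here (inj₁ (refl , refl)))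
labelled-mentions f (_ ∷ ps) es (here (inj₂ refl)) = Any-ʳ++⁺ʳ (labelled f ps) (here (inj₂ (refl , refl)))
labelled-mentions f (_ ∷ ps) es (there c)          = labelled-mentions f ps _ c

lookupLink-found : ∀ {n} {u v : Fin n} es → Any (Mentions u v) es → ∃ λ x → lookupLink es u v ≡ just x
lookupLink-found {u = u} {v} (entry a b x ∷ es) m with (a ≟ᵇ u) ∧ (b ≟ᵇ v) in c₁
... | true = x , refl
... | false with (a ≟ᵇ v) ∧ (b ≟ᵇ u) in c₂
...   | true = reverse x , refl
...   | false with m
...     | here (inj₁ (refl , refl)) = ⊥-elim (subst T c₁ (T-∧⁺ (≟ᵇ-refl a) (≟ᵇ-refl b)))
...     | here (inj₂ (refl , refl)) = ⊥-elim (subst T c₂ (T-∧⁺ (≟ᵇ-refl a) (≟ᵇ-refl b)))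
...     | there m′ = lookupLink-found es m′

module _ {n : ℕ} (P : LinkPattern n) where
  open LinkPattern P

  linkAt-correct : ∀ {es} → All (Agrees link) es → ∀ u v → u ≡ v ⊎ Any (Mentions u v) es →
    linkAt es u v ≡ link u v
  linkAt-correct {es} oks u v c with lookupLink es u v in found
  ... | just x  = sym (lookupLink-sound P oks found)
  ... | nothing with c
  ...   | inj₁ refl = sym (link-refl u)
  ...   | inj₂ m with lookupLink-found es m
  ...     | _ , e with () ← trans (sym found) e

module Classification {n k : ℕ} (D : MultipartiteTournament n k) where
  open MultipartiteTournament D
  open TournamentLinks D

  part-count : ∀ {m} (rep : Fin m → Fin n) → (∀ {i j} → part (rep i) ≡ part (rep j) → i ≡ j) →
    (∀ v → ∃ λ i → part v ≡ part (rep i)) → m ≡ k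
  part-count {m} rep rep-apart covers = ≤-antisym (injective⇒≤ rep-apart) (injective⇒≤ classOf-injective)
    where
    witness : Fin k → Fin n
    witness i = proj₁ (nonempty i)
    classOf : Fin k → Fin m
    classOf i = proj₁ (covers (witness i))
    classOf-injective : ∀ {i j} → classOf i ≡ classOf j → i ≡ j
    classOf-injective {i} {j} e = begin
      i                      ≡⟨ sym (proj₂ (nonempty i)) ⟩
      part (witness i)       ≡⟨ proj₂ (covers (witness i)) ⟩
      part (rep (classOf i)) ≡⟨ cong (part ∘ rep) e ⟩
      part (rep (classOf j)) ≡⟨ sym (proj₂ (covers (witness j))) ⟩
      part (witness j)       ≡⟨ proj₂ (nonempty j) ⟩
      j                      ∎
      where open ≡-Reasoning

  module Leaf (tf : TriangleFree NG) (covered : T (coversAllPairs n)) where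
    P : LinkPattern n
    P = linkPattern tf
    es : List (Entry n)
    es = labelled linkOf (orderedPairs n) ʳ++ []
    agrees : All (Agrees linkOf) es
    agrees = labelled-agrees linkOf (orderedPairs n) []
    linkAt-es : ∀ u v → linkAt es u v ≡ linkOf u v
    linkAt-es u v = linkAt-correct P agrees u v
      ([ inj₁ , inj₂ ∘ labelled-mentions linkOf (orderedPairs n) [] ]′ (coversAllPairs-sound covered u v))
    arcs niche : Rel n
    arcs  = lookupRel (tabulateRel (λ u v → isForward (linkAt es u v)))
    niche = lookupRel (tabulateRel (nicheᵇ arcs))
    arcs≡ : ∀ u v → arcs u v ≡ isForward (linkOf u v)
    arcs≡ u v = trans (lookup-tabulateRel _ u v) (cong isForward (linkAt-es u v))
    arcs⇒Arc : ∀ u v → T (arcs u v) → Arc u v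
    arcs⇒Arc u v t = linkOf-forward u v (isForward⇒≡ (subst T (arcs≡ u v) t))
    Arc⇒arcs : ∀ u v → Arc u v → T (arcs u v)
    Arc⇒arcs u v a = subst T (sym (trans (arcs≡ u v) (cong isForward (forward-linkOf u v a)))) tt
    niche⇒Adj : ∀ u v → T (niche u v) → Adj NG u v
    niche⇒Adj u v t = nicheᵇ⇒Adj arcs arcs⇒Arc Arc⇒arcs u v (subst T (lookup-tabulateRel _ u v) t)
    Adj⇒niche : ∀ u v → Adj NG u v → T (niche u v)
    Adj⇒niche u v a = subst T (sym (lookup-tabulateRel _ u v)) (Adj⇒nicheᵇ arcs arcs⇒Arc Arc⇒arcs u v a)
    fromMatched : ∀ {cands} → 3 ≤ k → Matched cands arcs niche → Any (λ c → k ≡ parts c × NG ≅ graph c) cands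
    fromMatched {cands} 3≤k matched = [ tooFew , Any.map (λ {c} → isCandidate c) ]′ few-or-matching
      where
      open Matched matched
      open Representatives representatives
      rep-distinct : ∀ {i j} → part (rep i) ≡ part (rep j) → i ≡ j
      rep-distinct {i} {j} e with i F.≟ j
      ... | yes i≡j = i≡j
      ... | no  i≢j = ⊥-elim ([ (λ a → arc-between _ _ (arcs⇒Arc _ _ a) e)
                               , (λ a → arc-between _ _ (arcs⇒Arc _ _ a) (sym e)) ]′ (rep-apart i j i≢j))
      k≡count : k ≡ count
      k≡count = sym (part-count rep rep-distinct (λ v → map₂ (sameᵇ⇒part-≡ arcs Arc⇒arcs v _) (rep-covers v)))
      tooFew : count < 3 → Any (λ c → k ≡ parts c × NG ≅ graph c) cands
      tooFew count<3 = ⊥-elim (<⇒≱ count<3 (subst (3 ≤_) k≡count 3≤k))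
      isCandidate : ∀ c → parts c ≡ count × Isoᵇ niche (adjᵇ c) → k ≡ parts c × NG ≅ graph c
      isCandidate c (parts≡count , iso) =
        trans k≡count (sym parts≡count) , Isoᵇ⇒≅ niche⇒Adj Adj⇒niche (adjᵇ⇒Adj c) (Adj⇒adjᵇ c) iso

    classified : (d : Fin n) (cands : List (Candidate n)) →
      Exhausts violates (leafVerdict d cands) →
      Connected NG → 3 ≤ k → Any (λ c → k ≡ parts c × NG ≅ graph c) cands
    classified d cands exhausted conn 3≤k
      with explore-sound violates (leafVerdict d cands) (orderedPairs n) [] (Exhausts⇒T exhausted) linkOf
    ... | inj₁ bad = ⊥-elim (noViolation linkOf violates (violates-sound P) agrees bad)
    ... | inj₂ leaf with verdict-sound d cands arcs niche leaf
    ...   | inj₁ (u , v , w , uv , vw , uw) =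
      ⊥-elim (tf u v w (niche⇒Adj _ _ uv , niche⇒Adj _ _ vw , niche⇒Adj _ _ uw))
    ...   | inj₂ (inj₁ sep)     = ⊥-elim (Separated-¬Reach Adj⇒niche sep (conn d))
    ...   | inj₂ (inj₂ matched) = fromMatched 3≤k matched

  classify : (d : Fin n) (cands : List (Candidate n)) →
    Exhausts violates (leafVerdict d cands) → T (coversAllPairs n) →
    TriangleFree NG → Connected NG → 3 ≤ k → Any (λ c → k ≡ parts c × NG ≅ graph c) cands
  classify d cands exhausted covered tf = Leaf.classified tf covered d cands exhausted

-- The listed graphs and their realisations

≡ᵇ-sound : ∀ {a b} → T (a ≡ᵇ b) → a ≡ b
≡ᵇ-sound {a} {b} = ≡ᵇ⇒≡ a b

≡ᵇ-complete : ∀ {a b} → a ≡ b → T (a ≡ᵇ b)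
≡ᵇ-complete {a} {b} = ≡⇒≡ᵇ a b

pathCandidate : ∀ m → ℕ → Candidate m
pathCandidate m k = record { parts = k ; graph = Path m ; adjᵇ = adjᵇ′ ; adjᵇ⇒Adj = sound ; Adj⇒adjᵇ = complete }
  where
  adjᵇ′ : Rel m
  adjᵇ′ u v = (toℕ v ≡ᵇ suc (toℕ u)) ∨ (toℕ u ≡ᵇ suc (toℕ v))
  sound : ∀ u v → T (adjᵇ′ u v) → Adj (Path m) u v
  sound u v t = [ inj₁ ∘ ≡ᵇ-sound , inj₂ ∘ ≡ᵇ-sound ]′ (T-∨⁻ {toℕ v ≡ᵇ suc (toℕ u)} t)
  complete : ∀ u v → Adj (Path m) u v → T (adjᵇ′ u v)
  complete u v (inj₁ e) = T-∨ˡ (≡ᵇ-complete e)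
  complete u v (inj₂ e) = T-∨ʳ {toℕ v ≡ᵇ suc (toℕ u)} (≡ᵇ-complete e)

cycleCandidate : ∀ m → ℕ → Candidate m
cycleCandidate m k = record { parts = k ; graph = Cycle m ; adjᵇ = adjᵇ′ ; adjᵇ⇒Adj = sound ; Adj⇒adjᵇ = complete }
  where
  step₁ step₂ wrap₁ wrap₂ : Rel m
  step₁ u v = toℕ v ≡ᵇ suc (toℕ u)
  step₂ u v = toℕ u ≡ᵇ suc (toℕ v)
  wrap₁ u v = (toℕ u ≡ᵇ 0) ∧ (toℕ v ≡ᵇ m ∸ 1)
  wrap₂ u v = (toℕ v ≡ᵇ 0) ∧ (toℕ u ≡ᵇ m ∸ 1)
  adjᵇ′ : Rel m
  adjᵇ′ u v = step₁ u v ∨ step₂ u v ∨ wrap₁ u v ∨ wrap₂ u v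
  sound : ∀ u v → T (adjᵇ′ u v) → Adj (Cycle m) u v
  sound u v t with T-∨⁻ {step₁ u v} t
  ... | inj₁ s = inj₁ (≡ᵇ-sound s)
  ... | inj₂ t₁ with T-∨⁻ {step₂ u v} t₁
  ...   | inj₁ s = inj₂ (inj₁ (≡ᵇ-sound s))
  ...   | inj₂ t₂ with T-∨⁻ {wrap₁ u v} t₂
  ...     | inj₁ w = inj₂ (inj₂ (inj₁ (≡ᵇ-sound (T-∧ˡ w) , ≡ᵇ-sound (T-∧ʳ {toℕ u ≡ᵇ 0} w))))
  ...     | inj₂ w = inj₂ (inj₂ (inj₂ (≡ᵇ-sound (T-∧ˡ w) , ≡ᵇ-sound (T-∧ʳ {toℕ v ≡ᵇ 0} w))))
  complete : ∀ u v → Adj (Cycle m) u v → T (adjᵇ′ u v)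
  complete u v (inj₁ e)        = T-∨ˡ (≡ᵇ-complete e)
  complete u v (inj₂ (inj₁ e)) = T-∨ʳ {step₁ u v} (T-∨ˡ (≡ᵇ-complete e))
  complete u v (inj₂ (inj₂ (inj₁ (e₁ , e₂)))) =
    T-∨ʳ {step₁ u v} (T-∨ʳ {step₂ u v} (T-∨ˡ (T-∧⁺ (≡ᵇ-complete e₁) (≡ᵇ-complete e₂))))
  complete u v (inj₂ (inj₂ (inj₂ (e₁ , e₂)))) =
    T-∨ʳ {step₁ u v} (T-∨ʳ {step₂ u v} (T-∨ʳ {wrap₁ u v} (T-∧⁺ (≡ᵇ-complete e₁) (≡ᵇ-complete e₂))))

edgesCandidate : ∀ m → List (ℕ × ℕ) → ℕ → Candidate m
edgesCandidate m es k = record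
  { parts = k ; graph = fromEdges m es ; adjᵇ = adjᵇ′ es ; adjᵇ⇒Adj = sound es ; Adj⇒adjᵇ = complete es }
  where
  edgeᵇ : Fin m → Fin m → ℕ × ℕ → Bool
  edgeᵇ u v (a , b) = ((toℕ u ≡ᵇ a) ∧ (toℕ v ≡ᵇ b)) ∨ ((toℕ v ≡ᵇ a) ∧ (toℕ u ≡ᵇ b))
  adjᵇ′ : List (ℕ × ℕ) → Rel m
  adjᵇ′ es u v = any (edgeᵇ u v) es
  sound : ∀ es u v → T (adjᵇ′ es u v) → Adj (fromEdges m es) u v
  sound es u v t = Any.map edge (any⁻ (edgeᵇ u v) es t)
    where
    edge : ∀ {e} → T (edgeᵇ u v e) → _
    edge {a , b} t with T-∨⁻ {(toℕ u ≡ᵇ a) ∧ (toℕ v ≡ᵇ b)} t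
    ... | inj₁ x = inj₁ (≡ᵇ-sound (T-∧ˡ x) , ≡ᵇ-sound (T-∧ʳ {toℕ u ≡ᵇ a} x))
    ... | inj₂ x = inj₂ (≡ᵇ-sound (T-∧ˡ x) , ≡ᵇ-sound (T-∧ʳ {toℕ v ≡ᵇ a} x))
  complete : ∀ es u v → Adj (fromEdges m es) u v → T (adjᵇ′ es u v)
  complete es u v a = any⁺ (edgeᵇ u v) (Any.map edge a)
    where
    edge : ∀ {e} → _ → T (edgeᵇ u v e)
    edge {a , b} (inj₁ (e₁ , e₂)) = T-∨ˡ (T-∧⁺ (≡ᵇ-complete e₁) (≡ᵇ-complete e₂))
    edge {a , b} (inj₂ (e₁ , e₂)) = T-∨ʳ {(toℕ u ≡ᵇ a) ∧ (toℕ v ≡ᵇ b)} (T-∧⁺ (≡ᵇ-complete e₁) (≡ᵇ-complete e₂))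

G₄-candidate : ℕ → Candidate 5
G₄-candidate = edgesCandidate 5 ((0 , 1) ∷ (0 , 3) ∷ (1 , 2) ∷ (2 , 3) ∷ (3 , 4) ∷ (4 , 1) ∷ [])

G₅-candidate : ℕ → Candidate 6
G₅-candidate = edgesCandidate 6 ((0 , 1) ∷ (1 , 2) ∷ (2 , 3) ∷ (3 , 4) ∷ (4 , 5) ∷ (5 , 0)
                               ∷ (0 , 3) ∷ (1 , 4) ∷ (2 , 5) ∷ [])

arcsFrom : ∀ {m} → List (ℕ × ℕ) → Rel m
arcsFrom es u v = any (λ (a , b) → (toℕ u ≡ᵇ a) ∧ (toℕ v ≡ᵇ b)) es

isTournamentᵇ : ∀ {m k} → Vec (Fin k) m → Rel m → Bool
isTournamentᵇ {m} {k} partOf arc =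
  (allᶠ m λ u → allᶠ m λ v →
     (not (arc u v) ∨ not (lookup partOf u ≟ᵇ lookup partOf v)) ∧
     ((lookup partOf u ≟ᵇ lookup partOf v) ∨ arc u v ∨ arc v u) ∧
     not (arc u v ∧ arc v u))
  ∧ (allᶠ k λ i → anyᶠ m λ v → lookup partOf v ≟ᵇ i)

module Realisation {m k : ℕ} (partOf : Vec (Fin k) m) (arc : Rel m) (valid : isTournamentᵇ partOf arc ≡ true) where

  private
    pairwise : ∀ u v → T (not (arc u v) ∨ not (lookup partOf u ≟ᵇ lookup partOf v))
                     × T ((lookup partOf u ≟ᵇ lookup partOf v) ∨ arc u v ∨ arc v u)
                     × T (not (arc u v ∧ arc v u))
    pairwise u v with allᶠ⇒∀ (allᶠ⇒∀ (T-∧ˡ (≡true⇒T valid)) u) v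
    ... | t = T-∧ˡ t , T-∧ˡ (T-∧ʳ {not (arc u v) ∨ _} t) , T-∧ʳ {(lookup partOf u ≟ᵇ _) ∨ _} (T-∧ʳ {not (arc u v) ∨ _} t)

  tournament : MultipartiteTournament m k
  tournament = record
    { part        = lookup partOf
    ; nonempty    = λ i → map₂ ≟ᵇ⇒≡ (anyᶠ⇒∃ (allᶠ⇒∀ (T-∧ʳ {allᶠ m _} (≡true⇒T valid)) i))
    ; Arc         = λ u v → T (arc u v)
    ; arc-between = λ u v uv same-part →
        [ (λ ¬uv → T-not⁻ ¬uv uv) , (λ ne → ≢ᵇ⇒≢ ne same-part) ]′ (T-∨⁻ (proj₁ (pairwise u v)))
    ; complete    = λ u v different →
        [ (λ same-part → ⊥-elim (different (≟ᵇ⇒≡ same-part))) , T-∨⁻ ]′ (T-∨⁻ (proj₁ (proj₂ (pairwise u v))))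
    ; antisym     = λ u v uv vu → T-not⁻ (proj₂ (proj₂ (pairwise u v))) (T-∧⁺ uv vu)
    }

  realises : (c : Candidate m) → (allᶠ m λ u → allᶠ m λ v → adjᵇ c u v ⇔ᵇ nicheᵇ arc u v) ≡ true →
    NicheRealizable (graph c) k
  realises c agree = tournament , Isoᵇ⇒≅ (adjᵇ⇒Adj c) (Adj⇒adjᵇ c)
    (nicheᵇ⇒Adj arc (λ _ _ t → t) (λ _ _ t → t)) (Adj⇒nicheᵇ arc (λ _ _ t → t) (λ _ _ t → t))
    (record { to = λ u → u ; from = λ u → u ; from∘to = λ _ → refl ; to∘from = λ _ → refl
            ; preserves = λ u v → T-⇔ᵇ (allᶠ⇒∀ (allᶠ⇒∀ (≡true⇒T agree) u) v) })
    where open TournamentLinks tournament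

-- At most six vertices

firstThree : Fin 7 → Fin 7 → Bool
firstThree zero       (suc zero)       = true
firstThree zero       (suc (suc zero)) = true
firstThree (suc zero) (suc (suc zero)) = true
firstThree _          _                = false

FirstThree : Fin 7 → Fin 7 → Set
FirstThree u v = (u ≡ zero × v ≡ suc zero) ⊎ (u ≡ zero × v ≡ suc (suc zero)) ⊎ (u ≡ suc zero × v ≡ suc (suc zero))

firstThree-sound : ∀ u v → T (firstThree u v) → FirstThree u v
firstThree-sound zero                (suc zero)             _ = inj₁ (refl , refl)
firstThree-sound zero                (suc (suc zero))       _ = inj₂ (inj₁ (refl , refl))
firstThree-sound (suc zero)          (suc (suc zero))       _ = inj₂ (inj₂ (refl , refl))
firstThree-sound zero                zero                   ()
firstThree-sound zero                (suc (suc (suc _)))    ()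
firstThree-sound (suc zero)          zero                   ()
firstThree-sound (suc zero)          (suc zero)             ()
firstThree-sound (suc zero)          (suc (suc (suc _)))    ()
firstThree-sound (suc (suc _))       _                      ()

-- Also pruning the labellings in which two of the vertices 0, 1, 2 share a part breaks enough
-- symmetry to make the seven-vertex search cheap.
violates₇ : Entry 7 → List (Entry 7) → Bool
violates₇ (entry u v x) es = violates (entry u v x) es ∨ (isSame x ∧ firstThree u v)

opaque
  unfolding Exhausts
  seven-vertices-refuted : Exhausts violates₇ (λ _ → false)
  seven-vertices-refuted = refl

no-pattern₇ : (P : LinkPattern 7) → let open LinkPattern P in
  link zero (suc zero) ≢ same → link zero (suc (suc zero)) ≢ same → link (suc zero) (suc (suc zero)) ≢ same → ⊥
no-pattern₇ P ¬01 ¬02 ¬12 =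
  explore-refutes link violates₇ seven-vertices-refuted violates₇-sound
  where
  open LinkPattern P
  shared-sound : ∀ u v → ¬ T (isSame (link u v) ∧ firstThree u v)
  shared-sound u v t with isSame⇒≡ {link u v} (T-∧ˡ t) | firstThree-sound u v (T-∧ʳ {isSame (link u v)} t)
  ... | e | inj₁ (refl , refl)         = ¬01 e
  ... | e | inj₂ (inj₁ (refl , refl))  = ¬02 e
  ... | e | inj₂ (inj₂ (refl , refl))  = ¬12 e
  violates₇-sound : ∀ {es} → All (Agrees link) es → ∀ u v → ¬ T (violates₇ (entry u v (link u v)) es)
  violates₇-sound {es} oks u v t =
    [ violates-sound P oks u v , shared-sound u v ]′ (T-∨⁻ {violates (entry u v (link u v)) es} t)

transpose-here : ∀ {n} (i j : Fin n) → transpose i j i ≡ j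
transpose-here i j rewrite dec-true (i F.≟ i) refl = refl

transpose-elsewhere : ∀ {n} {i j k : Fin n} → k ≢ i → k ≢ j → transpose i j k ≡ k
transpose-elsewhere {i = i} {j} {k} k≢i k≢j rewrite dec-false (k F.≟ i) k≢i | dec-false (k F.≟ j) k≢j = refl

transpose-injective : ∀ {n} (i j : Fin n) → Injective _≡_ _≡_ (transpose i j)
transpose-injective i j {x} {y} e =
  trans (sym (transpose-inverse j i)) (trans (cong (transpose j i) e) (transpose-inverse j i))

module _ {m n} (ι : Fin m → Fin n) (ι-injective : Injective _≡_ _≡_ ι) (i : Fin m) (x : Fin n) where

  redirect : Fin m → Fin n
  redirect = transpose (ι i) x ∘ ι

  redirect-injective : Injective _≡_ _≡_ redirect
  redirect-injective = ι-injective ∘ transpose-injective (ι i) x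

  redirect-hit : redirect i ≡ x
  redirect-hit = transpose-here (ι i) x

  redirect-keep : ∀ {j} → j ≢ i → ι j ≢ x → redirect j ≡ ι j
  redirect-keep j≢i ιj≢x = transpose-elsewhere (j≢i ∘ ι-injective) ιj≢x

injection-through : ∀ {r} (a b c : Fin (7 + r)) → a ≢ b → a ≢ c → b ≢ c →
  Σ (Fin 7 → Fin (7 + r)) λ ι → Injective _≡_ _≡_ ι × ι zero ≡ a × ι (suc zero) ≡ b × ι (suc (suc zero)) ≡ c
injection-through {r} a b c a≢b a≢c b≢c = ι₃ , ι₃-injective , ι₃0≡a , ι₃1≡b , redirect-hit ι₂ ι₂-injective two c
  where
  one two : Fin 7
  one = suc zero
  two = suc (suc zero)
  ι₀ ι₁ ι₂ ι₃ : Fin 7 → Fin (7 + r)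
  ι₀ = _↑ˡ r
  ι₀-injective : Injective _≡_ _≡_ ι₀
  ι₀-injective = ↑ˡ-injective r _ _
  ι₁ = redirect ι₀ ι₀-injective zero a
  ι₁-injective = redirect-injective ι₀ ι₀-injective zero a
  ι₂ = redirect ι₁ ι₁-injective one b
  ι₂-injective = redirect-injective ι₁ ι₁-injective one b
  ι₃ = redirect ι₂ ι₂-injective two c
  ι₃-injective = redirect-injective ι₂ ι₂-injective two c
  ι₂0≡a : ι₂ zero ≡ a
  ι₂0≡a = trans (redirect-keep ι₁ ι₁-injective one b {zero} (λ ()) λ e → a≢b (trans (sym (redirect-hit ι₀ ι₀-injective zero a)) e))
                (redirect-hit ι₀ ι₀-injective zero a)
  ι₃0≡a : ι₃ zero ≡ a
  ι₃0≡a = trans (redirect-keep ι₂ ι₂-injective two c {zero} (λ ()) λ e → a≢c (trans (sym ι₂0≡a) e)) ι₂0≡a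
  ι₃1≡b : ι₃ one ≡ b
  ι₃1≡b = trans (redirect-keep ι₂ ι₂-injective two c {one} (λ ())
                  λ e → b≢c (trans (sym (redirect-hit ι₁ ι₁-injective one b)) e))
                (redirect-hit ι₁ ι₁-injective one b)

at-most-six-vertices : ∀ {n k} (D : MultipartiteTournament n k) → TriangleFree (NicheGraph D) → 3 ≤ k → 7 ≤ n → ⊥
at-most-six-vertices {suc (suc (suc (suc (suc (suc (suc r))))))} {suc (suc (suc k))} D tf
  (s≤s (s≤s (s≤s _))) (s≤s (s≤s (s≤s (s≤s (s≤s (s≤s (s≤s _))))))) with
  injection-through (witness zero) (witness (suc zero)) (witness (suc (suc zero)))
    (witness-apart (λ ())) (witness-apart (λ ())) (witness-apart (λ ()))
  where
  open MultipartiteTournament D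
  witness : Fin (3 + k) → Fin (7 + r)
  witness i = proj₁ (nonempty i)
  witness-apart : ∀ {i j} → i ≢ j → witness i ≢ witness j
  witness-apart {i} {j} i≢j e = i≢j (trans (sym (proj₂ (nonempty i))) (trans (cong part e) (proj₂ (nonempty j))))
... | ι , ι-injective , ι0 , ι1 , ι2 =
  no-pattern₇ (restrict (linkPattern tf) ι ι-injective) (apart (λ ()) ι0 ι1) (apart (λ ()) ι0 ι2) (apart (λ ()) ι1 ι2)
  where
  open MultipartiteTournament D
  open TournamentLinks D
  apart : ∀ {i j} → i ≢ j → ∀ {x y} → x ≡ proj₁ (nonempty i) → y ≡ proj₁ (nonempty j) → linkOf x y ≢ same
  apart {i} {j} i≢j refl refl e =
    i≢j (trans (sym (proj₂ (nonempty i))) (trans (linkOf-same _ _ e) (proj₂ (nonempty j))))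

-- Graphs on three to six vertices

Classified : ∀ {n} → List (Candidate n) → Graph n → ℕ → Set₁
Classified cands G k = Any (λ c → k ≡ parts c × G ≅ graph c) cands

classify-realizable : ∀ {n k} (d : Fin n) (cands : List (Candidate n)) →
  Exhausts violates (leafVerdict d cands) → T (coversAllPairs n) →
  ∀ {G : Graph n} → TriangleFree G → Connected G → 3 ≤ k → NicheRealizable G k → Classified cands G k
classify-realizable d cands exhausted covered tf conn 3≤k (D , G≅N) =
  Any.map (λ {c} → map₂ (≅-trans {H = graph c} G≅N))
    (Classification.classify D d cands exhausted covered
      (TriangleFree-resp-≅ G≅N tf) (Connected-resp-≅ G≅N conn) 3≤k)

candidates₃ : List (Candidate 3)
candidates₃ = pathCandidate 3 3 ∷ []

candidates₄ : List (Candidate 4)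
candidates₄ = pathCandidate 4 3 ∷ pathCandidate 4 4 ∷ []

candidates₅ : List (Candidate 5)
candidates₅ = pathCandidate 5 3 ∷ cycleCandidate 5 3 ∷ cycleCandidate 5 4 ∷ cycleCandidate 5 5 ∷ G₄-candidate 3 ∷ []

candidates₆ : List (Candidate 6)
candidates₆ = cycleCandidate 6 3 ∷ G₅-candidate 3 ∷ []

opaque
  unfolding Exhausts
  exhaustive₃ : Exhausts violates (leafVerdict zero candidates₃)
  exhaustive₃ = refl

  exhaustive₄ : Exhausts violates (leafVerdict zero candidates₄)
  exhaustive₄ = refl

  exhaustive₅ : Exhausts violates (leafVerdict zero candidates₅)
  exhaustive₅ = refl

  exhaustive₆ : Exhausts violates (leafVerdict zero candidates₆)
  exhaustive₆ = refl

Listed : ∀ {n} → Graph n → ℕ → Set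
Listed G k =
  (k ≡ 3 × (G ≅ Path 3 ⊎ G ≅ Path 4 ⊎ G ≅ Path 5 ⊎ G ≅ Cycle 5 ⊎ G ≅ Cycle 6 ⊎ G ≅ G₄ ⊎ G ≅ G₅))
  ⊎ (k ≡ 4 × (G ≅ Path 4 ⊎ G ≅ Cycle 5))
  ⊎ (k ≡ 5 × G ≅ Cycle 5)

listed₃ : ∀ {G : Graph 3} {k} → Classified candidates₃ G k → Listed G k
listed₃ (here (e , i)) = inj₁ (e , inj₁ i)

listed₄ : ∀ {G : Graph 4} {k} → Classified candidates₄ G k → Listed G k
listed₄ (here (e , i))         = inj₁ (e , inj₂ (inj₁ i))
listed₄ (there (here (e , i))) = inj₂ (inj₁ (e , inj₁ i))

listed₅ : ∀ {G : Graph 5} {k} → Classified candidates₅ G k → Listed G k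
listed₅ (here (e , i))                                 = inj₁ (e , inj₂ (inj₂ (inj₁ i)))
listed₅ (there (here (e , i)))                         = inj₁ (e , inj₂ (inj₂ (inj₂ (inj₁ i))))
listed₅ (there (there (here (e , i))))                 = inj₂ (inj₁ (e , inj₂ i))
listed₅ (there (there (there (here (e , i)))))         = inj₂ (inj₂ (e , i))
listed₅ (there (there (there (there (here (e , i)))))) = inj₁ (e , inj₂ (inj₂ (inj₂ (inj₂ (inj₂ (inj₁ i))))))

listed₆ : ∀ {G : Graph 6} {k} → Classified candidates₆ G k → Listed G k
listed₆ (here (e , i))         = inj₁ (e , inj₂ (inj₂ (inj₂ (inj₂ (inj₁ i)))))
listed₆ (there (here (e , i))) = inj₁ (e , inj₂ (inj₂ (inj₂ (inj₂ (inj₂ (inj₂ i))))))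

realizable⇒listed : ∀ n (G : Graph n) → Connected G → TriangleFree G → 3 ≤ n →
  ∀ k → 3 ≤ k → NicheRealizable G k → Listed G k
realizable⇒listed 0 _ _ _ ()
realizable⇒listed 1 _ _ _ (s≤s ())
realizable⇒listed 2 _ _ _ (s≤s (s≤s ()))
realizable⇒listed 3 G conn tf _ k 3≤k = listed₃ ∘ classify-realizable zero candidates₃ exhaustive₃ tt tf conn 3≤k
realizable⇒listed 4 G conn tf _ k 3≤k = listed₄ ∘ classify-realizable zero candidates₄ exhaustive₄ tt tf conn 3≤k
realizable⇒listed 5 G conn tf _ k 3≤k = listed₅ ∘ classify-realizable zero candidates₅ exhaustive₅ tt tf conn 3≤k
realizable⇒listed 6 G conn tf _ k 3≤k = listed₆ ∘ classify-realizable zero candidates₆ exhaustive₆ tt tf conn 3≤k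
realizable⇒listed (suc (suc (suc (suc (suc (suc (suc r))))))) G conn tf _ k 3≤k (D , G≅N) =
  ⊥-elim (at-most-six-vertices D (TriangleFree-resp-≅ G≅N tf) 3≤k (m≤m+n 7 r))

P₃-realizable₃ : NicheRealizable (Path 3) 3
P₃-realizable₃ = Realisation.realises (# 0 ∷ # 1 ∷ # 2 ∷ [])
  (arcsFrom ((0 , 1) ∷ (0 , 2) ∷ (1 , 2) ∷ [])) refl (pathCandidate 3 3) refl

P₄-realizable₃ : NicheRealizable (Path 4) 3
P₄-realizable₃ = Realisation.realises (# 0 ∷ # 0 ∷ # 1 ∷ # 2 ∷ [])
  (arcsFrom ((0 , 2) ∷ (3 , 0) ∷ (1 , 2) ∷ (1 , 3) ∷ (2 , 3) ∷ [])) refl (pathCandidate 4 3) refl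

P₄-realizable₄ : NicheRealizable (Path 4) 4
P₄-realizable₄ = Realisation.realises (# 0 ∷ # 1 ∷ # 2 ∷ # 3 ∷ [])
  (arcsFrom ((0 , 1) ∷ (0 , 2) ∷ (3 , 0) ∷ (1 , 2) ∷ (1 , 3) ∷ (2 , 3) ∷ [])) refl (pathCandidate 4 4) refl

P₅-realizable₃ : NicheRealizable (Path 5) 3
P₅-realizable₃ = Realisation.realises (# 0 ∷ # 0 ∷ # 1 ∷ # 2 ∷ # 2 ∷ [])
  (arcsFrom ((0 , 2) ∷ (3 , 0) ∷ (4 , 0) ∷ (1 , 2) ∷ (1 , 3) ∷ (4 , 1) ∷ (2 , 3) ∷ (2 , 4) ∷ []))
  refl (pathCandidate 5 3) refl

C₅-realizable₃ : NicheRealizable (Cycle 5) 3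
C₅-realizable₃ = Realisation.realises (# 0 ∷ # 0 ∷ # 0 ∷ # 1 ∷ # 2 ∷ [])
  (arcsFrom ((0 , 3) ∷ (0 , 4) ∷ (3 , 1) ∷ (1 , 4) ∷ (3 , 2) ∷ (4 , 2) ∷ (4 , 3) ∷ []))
  refl (cycleCandidate 5 3) refl

C₅-realizable₄ : NicheRealizable (Cycle 5) 4
C₅-realizable₄ = Realisation.realises (# 0 ∷ # 0 ∷ # 1 ∷ # 2 ∷ # 3 ∷ [])
  (arcsFrom ((0 , 2) ∷ (3 , 0) ∷ (4 , 0) ∷ (1 , 2) ∷ (1 , 3) ∷ (4 , 1) ∷ (2 , 3) ∷ (2 , 4) ∷ (3 , 4) ∷ []))
  refl (cycleCandidate 5 4) refl

C₅-realizable₅ : NicheRealizable (Cycle 5) 5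
C₅-realizable₅ = Realisation.realises (# 0 ∷ # 1 ∷ # 2 ∷ # 3 ∷ # 4 ∷ [])
  (arcsFrom ((0 , 1) ∷ (0 , 2) ∷ (3 , 0) ∷ (4 , 0) ∷ (1 , 2) ∷ (1 , 3) ∷ (4 , 1) ∷ (2 , 3) ∷ (2 , 4) ∷ (3 , 4) ∷ []))
  refl (cycleCandidate 5 5) refl

C₆-realizable₃ : NicheRealizable (Cycle 6) 3
C₆-realizable₃ = Realisation.realises (# 0 ∷ # 1 ∷ # 2 ∷ # 0 ∷ # 1 ∷ # 2 ∷ [])
  (arcsFrom ((0 , 1) ∷ (0 , 2) ∷ (4 , 0) ∷ (5 , 0) ∷ (1 , 2) ∷ (1 , 3) ∷ (5 , 1) ∷ (2 , 3) ∷ (2 , 4)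
             ∷ (3 , 4) ∷ (3 , 5) ∷ (4 , 5) ∷ []))
  refl (cycleCandidate 6 3) refl

G₄-realizable₃ : NicheRealizable G₄ 3
G₄-realizable₃ = Realisation.realises (# 0 ∷ # 0 ∷ # 1 ∷ # 1 ∷ # 2 ∷ [])
  (arcsFrom ((0 , 2) ∷ (3 , 0) ∷ (4 , 0) ∷ (2 , 1) ∷ (3 , 1) ∷ (1 , 4) ∷ (2 , 4) ∷ (4 , 3) ∷ []))
  refl (G₄-candidate 3) refl

G₅-realizable₃ : NicheRealizable G₅ 3
G₅-realizable₃ = Realisation.realises (# 0 ∷ # 0 ∷ # 1 ∷ # 1 ∷ # 2 ∷ # 2 ∷ [])
  (arcsFrom ((0 , 2) ∷ (0 , 3) ∷ (4 , 0) ∷ (5 , 0) ∷ (1 , 2) ∷ (3 , 1) ∷ (4 , 1) ∷ (1 , 5) ∷ (2 , 4)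
             ∷ (2 , 5) ∷ (3 , 4) ∷ (5 , 3) ∷ []))
  refl (G₅-candidate 3) refl

listed⇒realizable : ∀ {n} {G : Graph n} {k} → Listed G k → NicheRealizable G k
listed⇒realizable (inj₁ (refl , inj₁ G≅P₃)) = NicheRealizable-resp-≅ G≅P₃ P₃-realizable₃
listed⇒realizable (inj₁ (refl , inj₂ (inj₁ G≅P₄))) = NicheRealizable-resp-≅ G≅P₄ P₄-realizable₃
listed⇒realizable (inj₁ (refl , inj₂ (inj₂ (inj₁ G≅P₅)))) = NicheRealizable-resp-≅ G≅P₅ P₅-realizable₃
listed⇒realizable (inj₁ (refl , inj₂ (inj₂ (inj₂ (inj₁ G≅C₅))))) = NicheRealizable-resp-≅ G≅C₅ C₅-realizable₃
listed⇒realizable (inj₁ (refl , inj₂ (inj₂ (inj₂ (inj₂ (inj₁ G≅C₆)))))) = NicheRealizable-resp-≅ G≅C₆ C₆-realizable₃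
listed⇒realizable (inj₁ (refl , inj₂ (inj₂ (inj₂ (inj₂ (inj₂ (inj₁ G≅G₄))))))) = NicheRealizable-resp-≅ G≅G₄ G₄-realizable₃
listed⇒realizable (inj₁ (refl , inj₂ (inj₂ (inj₂ (inj₂ (inj₂ (inj₂ G≅G₅))))))) = NicheRealizable-resp-≅ G≅G₅ G₅-realizable₃
listed⇒realizable (inj₂ (inj₁ (refl , inj₁ G≅P₄))) = NicheRealizable-resp-≅ G≅P₄ P₄-realizable₄
listed⇒realizable (inj₂ (inj₁ (refl , inj₂ G≅C₅))) = NicheRealizable-resp-≅ G≅C₅ C₅-realizable₄
listed⇒realizable (inj₂ (inj₂ (refl , G≅C₅))) = NicheRealizable-resp-≅ G≅C₅ C₅-realizable₅

theorem4p12 : ∀ (n : ℕ) (G : Graph n) → IsSimple G → Connected G → TriangleFree G → 3 ≤ n →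
    ∀ (k : ℕ) → 3 ≤ k →
      NicheRealizable G k ⇔
        ((k ≡ 3 × (G ≅ Path 3 ⊎ G ≅ Path 4 ⊎ G ≅ Path 5 ⊎ G ≅ Cycle 5 ⊎ G ≅ Cycle 6 ⊎ G ≅ G₄ ⊎ G ≅ G₅))
        ⊎ (k ≡ 4 × (G ≅ Path 4 ⊎ G ≅ Cycle 5))
        ⊎ (k ≡ 5 × G ≅ Cycle 5))
theorem4p12 n G _ conn tf 3≤n k 3≤k = mk⇔ (realizable⇒listed n G conn tf 3≤n k 3≤k) listed⇒realizable
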